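{- For each even integer $k\geqslant0$, $$\delta\Big(\sum_{\mathbf{a}\in\mathcal{A}_k}(-1)^{\mathrm{depth}(\mathbf{a})}[\mathbf{a}]\Big)=\sum_{\mathbf{a}\in\mathcal{A}_k^{\rm even}}(-3)^{\mathrm{depth}(\mathbf{a})}\,\mathbf{a},$$ where $\mathcal{A}_k^{\rm even}$ is the set of admissible compositions of weight $k$ all of whose entries are even.
   Context: A composition is a finite sequence $\mathbf{a}=(a_1,\ldots,a_r)$ of positive integers ($r\geqslant0$), of depth $r$ and weight $\sum a_i$; admissible if $r=0$ or $a_1\geqslant2$. $\mathcal{A}$ (resp. $\mathcal{A}_k$) is the set of admissible compositions (resp. of weight $k$). Binary word $\mathbf{w}(\mathbf{a})=0^{a_1-1}1\cdots0^{a_r-1}1$; the dual of a word $\varepsilon_1\cdots\varepsilon_k$ is $\overline{\varepsilon_k}\cdots\overline{\varepsilon_1}$ ($\overline0=1,\overline1=0$); $\overline{\mathbf{a}}$ is the admissible composition with word dual to $\mathbf{w}(\mathbf{a})$. $\mathcal{B}=\mathcal{A}/(\mathbf{a}\sim\overline{\mathbf{a}})$, classes $[\mathbf{a}]$, $\mathcal{B}_k$ classes of weight $k$; $\mathbf{Z}^{(X)}$ is the free $\mathbf{Z}$-module on $X$. $(a_1,\ldots,a_r)^{\rm init}=(a_1,\ldots,a_{r-1})$ ($\varnothing^{\rm init}=\varnothing$); for admissible $\mathbf{a}$, $\mathbf{a}^{\rm fin}$ is the dual of $(\overline{\mathbf{a}})^{\rm init}$ and $\mathbf{a}^{\rm mid}=(\mathbf{a}^{\rm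 fin})^{\rm init}$; extended $\mathbf{Z}$-linearly. $\delta$ is the unique $\mathbf{Z}$-linear map $\mathbf{Z}^{(\mathcal{B})}\to\mathbf{Z}^{(\mathcal{A})}$ with $\delta(\mathbf{Z}^{\mathcal{B}_k})\subset\mathbf{Z}^{\mathcal{A}_k}$ for all $k$, $\delta([\varnothing])=\varnothing$, and $\delta([\mathbf{a}])^{\rm init}=\delta([\mathbf{a}^{\rm init}])+\delta([\mathbf{a}^{\rm mid}])+\delta([\mathbf{a}^{\rm fin}])$ for all non-empty admissible $\mathbf{a}$. -}

module Defs where

open import Data.Bool using (Bool; true; false; not; _∧_)
open import Data.Nat as ℕ using (ℕ; zero; suc; _≤_; _∸_)
open import Data.Integer as ℤ using (ℤ; +_; -[1+_]; 0ℤ; 1ℤ; -1ℤ)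
open import Data.List using (List; []; _∷_; _++_; map; reverse; concatMap; length; filterᵇ; foldr)
open import Data.List.Properties using (≡-dec)
open import Data.List.Relation.Unary.All using (All)
open import Data.Product using (_×_; _,_)
open import Data.Unit using (⊤)
open import Relation.Nullary using (yes; no)
open import Relation.Binary.PropositionalEquality using (_≡_)

-- Compositions: finite lists of natural numbers (entries meant positive)

Composition : Set
Composition = List ℕ

weight : Composition → ℕ
weight = foldr ℕ._+_ 0

depth : Composition → ℕ
depth = length

Admissible : Composition → Set
Admissible []       = ⊤
Admissible (x ∷ xs) = (2 ≤ x) × All (1 ≤_) xs

bump : Composition → Composition
bump []       = []
bump (a ∷ r)  = suc a ∷ r

nonEmpty : Composition → Bool
nonEmpty []      = false
nonEmpty (_ ∷ _) = true

compositions : ℕ → List Composition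
compositions zero    = [] ∷ []
compositions (suc n) =
  map (1 ∷_) (compositions n) ++ map bump (filterᵇ nonEmpty (compositions n))

admissibleᵇ : Composition → Bool
admissibleᵇ []            = true
admissibleᵇ (zero ∷ _)    = false
admissibleᵇ (suc zero ∷ _) = false
admissibleᵇ (suc (suc _) ∷ _) = true

𝒜 : ℕ → List Composition
𝒜 k = filterᵇ admissibleᵇ (compositions k)

evenᵇ : ℕ → Bool
evenᵇ zero          = true
evenᵇ (suc zero)    = false
evenᵇ (suc (suc n)) = evenᵇ n

allEvenᵇ : Composition → Bool
allEvenᵇ []       = true
allEvenᵇ (x ∷ xs) = evenᵇ x ∧ allEvenᵇ xs

𝒜even : ℕ → List Composition
𝒜even k = filterᵇ allEvenᵇ (𝒜 k)

-- w(a) = 0^{a1-1} 1 ... 0^{ar-1} 1   (false = 0, true = 1)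
word : Composition → List Bool
word []       = []
word (a ∷ as) = rep (a ∸ 1) ++ (true ∷ word as)
  where
  rep : ℕ → List Bool
  rep zero    = []
  rep (suc n) = false ∷ rep n

-- inverse of word on words ending with 1 (acc counts the pending 0's)
fromWord′ : ℕ → List Bool → Composition
fromWord′ acc []            = []
fromWord′ acc (true ∷ w)    = suc acc ∷ fromWord′ 0 w
fromWord′ acc (false ∷ w)   = fromWord′ (suc acc) w

fromWord : List Bool → Composition
fromWord = fromWord′ 0

dualWord : List Bool → List Bool
dualWord w = reverse (map not w)

dual : Composition → Composition
dual a = fromWord (dualWord (word a))

init : Composition → Composition
init []           = []
init (x ∷ [])     = []
init (x ∷ y ∷ r)  = x ∷ init (y ∷ r)

fin : Composition → Composition
fin a = dual (init (dual a))

mid : Composition → Composition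
mid a = init (fin a)

-- The free ℤ-module ℤ^(compositions): formal ℤ-linear combinations,
-- represented by lists of (coefficient, composition), compared via
-- their coefficient functions.

FormalSum : Set
FormalSum = List (ℤ × Composition)

coeff : FormalSum → Composition → ℤ
coeff []             b = 0ℤ
coeff ((c , a) ∷ xs) b with ≡-dec ℕ._≟_ a b
... | yes _ = c ℤ.+ coeff xs b
... | no  _ = coeff xs b

infix 4 _≈_
_≈_ : FormalSum → FormalSum → Set
x ≈ y = ∀ b → coeff x b ≡ coeff y b

infixl 6 _⊕_
_⊕_ : FormalSum → FormalSum → FormalSum
_⊕_ = _++_

_·_ : ℤ → FormalSum → FormalSum
c · x = map (λ { (d , a) → (c ℤ.* d , a) }) x

basis : Composition → FormalSum
basis a = (1ℤ , a) ∷ []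

initFS : FormalSum → FormalSum
initFS = map (λ { (c , a) → (c , init a) })

sumFS : List FormalSum → FormalSum
sumFS = foldr _⊕_ []

-- Write lhs k c and rhs k c for the coefficients of c on the two sides, for every k (not only even
-- ones). Both families vanish for odd k: on the left because a ↦ a̅ is a weight-preserving involution
-- of 𝒜_k with depth a + depth a̅ = k, so it flips the sign (−1)^depth. Both are [c = ∅] for k = 0,
-- vanish off weight k, and for even k ≥ 2 and c of weight k satisfy
--   f k c = −3 · ∑_{u<k} f u (c^init),
-- hence coincide by strong induction on k. On the right this is just removing the last entry of an
-- all-even composition. On the left, δ(a) is homogeneous, so applying ^init to the defining relation
-- writes lhs k c as three signed sums over 𝒜_k of the coefficients of c^init in δ(a^init), δ(a^mid)
-- and δ(a^fin). Grouping a by its last entry gives −∑_{u<k} lhs u (c^init) for the first; since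
-- a^fin is the dual of (a̅)^init, the same holds for the third; and the middle one becomes an
-- alternating sum over w < k of such partial sums, which telescopes to the same value.
module Submission where

open import Defs
open import Algebra.Bundles using (CommutativeMonoid)
open import Data.Bool using (Bool; true; false; not; _∧_; if_then_else_; T)
import Data.Bool.Properties as BoolP
open import Data.Empty using (⊥-elim)
open import Data.Integer as ℤ using (ℤ; -[1+_]; _^_; 0ℤ; -1ℤ; 1ℤ; _+_; _*_; -_)
import Data.Integer.Properties as ℤP
open import Data.Integer.Solver using (module +-*-Solver)
open import Data.List using (List; []; _∷_; _∷ʳ_; map; _++_; filterᵇ; foldr; length; reverse; replicate; initLast; _∷ʳ′_)
import Data.List.Properties as ListP
open import Data.List.Properties using (≡-dec)
open import Data.List.Membership.Propositional using (_∈_)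
import Data.List.Membership.Propositional.Properties as ∈P
open import Data.List.Membership.Propositional.Properties.WithK using (unique∧set⇒bag)
open import Data.List.Relation.Binary.BagAndSetEquality using (∼bag⇒↭)
open import Data.List.Relation.Binary.Permutation.Propositional using (_↭_; ↭-sym; ↭⇒↭ₛ)
import Data.List.Relation.Binary.Permutation.Propositional.Properties as ↭P
open import Data.List.Relation.Binary.Permutation.Setoid.Properties using (foldr-commMonoid)
open import Data.List.Relation.Unary.All as All using (All; []; _∷_)
import Data.List.Relation.Unary.All.Properties as AllP
open import Data.List.Relation.Unary.AllPairs using ([]; _∷_)
open import Data.List.Relation.Unary.Any using (here; there)
open import Data.List.Relation.Unary.Unique.Propositional using (Unique)
import Data.List.Relation.Unary.Unique.Propositional.Properties as UniqueP
open import Data.Nat as ℕ using (ℕ; zero; suc; _≤_; _<_; _∸_; z≤n; s≤s)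
open import Data.Nat.Induction using (<-rec)
open import Data.Nat.ListAction.Properties using (sum-++)
import Data.Nat.Properties as ℕP
open import Data.Product using (_×_; _,_; proj₁; proj₂; ∃)
open import Data.Sum using (inj₁; inj₂)
open import Data.Unit using (tt)
open import Function using (_∘_; mk⇔)
open import Relation.Nullary using (¬_; yes; no; does; contradiction)
open import Relation.Nullary.Decidable using (T?)
open import Relation.Binary.PropositionalEquality

private
  variable
    A : Set

∑ : List A → (A → ℤ) → ℤ
∑ xs f = foldr _+_ 0ℤ (map f xs)

syntax ∑ xs (λ x → e) = ∑[ x ∈ xs ] e

∑-++ : ∀ (xs ys : List A) f → ∑ (xs ++ ys) f ≡ ∑ xs f + ∑ ys f
∑-++ []       ys f = sym (ℤP.+-identityˡ _)
∑-++ (x ∷ xs) ys f = trans (cong (f x +_) (∑-++ xs ys f)) (sym (ℤP.+-assoc (f x) _ _))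

∑-cong : ∀ (xs : List A) {f g} → (∀ {x} → x ∈ xs → f x ≡ g x) → ∑ xs f ≡ ∑ xs g
∑-cong []       eq = refl
∑-cong (x ∷ xs) eq = cong₂ _+_ (eq (here refl)) (∑-cong xs (eq ∘ there))

∑-↭ : ∀ {xs ys : List A} f → xs ↭ ys → ∑ xs f ≡ ∑ ys f
∑-↭ f p = foldr-commMonoid CM.setoid CM.isCommutativeMonoid (↭⇒↭ₛ (↭P.map⁺ f p))
  where module CM = CommutativeMonoid ℤP.+-0-commutativeMonoid

∑-+ : ∀ (xs : List A) f g → ∑[ x ∈ xs ] (f x + g x) ≡ ∑ xs f + ∑ xs g
∑-+ []       f g = refl
∑-+ (x ∷ xs) f g = trans (cong (f x + g x +_) (∑-+ xs f g)) (+-interchange (f x) (g x) _ _)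
  where
  +-interchange : ∀ a b c d → a + b + (c + d) ≡ a + c + (b + d)
  +-interchange = solve 4 (λ a b c d → a :+ b :+ (c :+ d) := a :+ c :+ (b :+ d)) refl
    where open +-*-Solver

∑-*ˡ : ∀ (xs : List A) c f → ∑[ x ∈ xs ] (c * f x) ≡ c * ∑ xs f
∑-*ˡ []       c f = sym (ℤP.*-zeroʳ c)
∑-*ˡ (x ∷ xs) c f = trans (cong (c * f x +_) (∑-*ˡ xs c f)) (sym (ℤP.*-distribˡ-+ c (f x) _))

∑-neg : ∀ (xs : List A) f → ∑[ x ∈ xs ] (- f x) ≡ - ∑ xs f
∑-neg xs f = begin
  ∑[ x ∈ xs ] (- f x)    ≡⟨ ∑-cong xs (λ {x} _ → sym (ℤP.-1*i≡-i (f x))) ⟩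
  ∑[ x ∈ xs ] (-1ℤ * f x) ≡⟨ ∑-*ˡ xs -1ℤ f ⟩
  -1ℤ * ∑ xs f            ≡⟨ ℤP.-1*i≡-i _ ⟩
  - ∑ xs f                ∎
  where open ≡-Reasoning

∑-zero : ∀ (xs : List A) {f} → (∀ {x} → x ∈ xs → f x ≡ 0ℤ) → ∑ xs f ≡ 0ℤ
∑-zero []       eq = refl
∑-zero (x ∷ xs) eq = cong₂ _+_ (eq (here refl)) (∑-zero xs (eq ∘ there))

∑-map : ∀ {B : Set} (g : A → B) xs f → ∑ (map g xs) f ≡ ∑[ x ∈ xs ] f (g x)
∑-map g xs f = cong (foldr _+_ 0ℤ) (sym (ListP.map-∘ xs))

∑-filterᵇ : ∀ p (xs : List A) f → ∑ (filterᵇ p xs) f ≡ ∑[ x ∈ xs ] (if p x then f x else 0ℤ)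
∑-filterᵇ p []       f = refl
∑-filterᵇ p (x ∷ xs) f with p x
... | true  = cong (f x +_) (∑-filterᵇ p xs f)
... | false = trans (∑-filterᵇ p xs f) (sym (ℤP.+-identityˡ _))

Unique-map⁺ : ∀ {B : Set} (f : A → B) {xs} → (∀ {x y} → x ∈ xs → y ∈ xs → f x ≡ f y → x ≡ y) →
  Unique xs → Unique (map f xs)
Unique-map⁺ f inj []           = []
Unique-map⁺ f inj (x∉ ∷ uniq) =
  AllP.map⁺ (All.tabulate λ y∈ fx≡fy → All.lookup x∉ y∈ (inj (here refl) (there y∈) fx≡fy))
  ∷ Unique-map⁺ f (λ x∈ y∈ → inj (there x∈) (there y∈)) uniq

∑< : ℕ → (ℕ → ℤ) → ℤ
∑< zero    f = 0ℤ
∑< (suc n) f = ∑< n f + f n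

∑<-cong : ∀ n {f g} → (∀ {w} → w < n → f w ≡ g w) → ∑< n f ≡ ∑< n g
∑<-cong zero    eq = refl
∑<-cong (suc n) eq = cong₂ _+_ (∑<-cong n (eq ∘ ℕP.m<n⇒m<1+n)) (eq (ℕP.n<1+n n))

∑<-*ˡ : ∀ n c f → ∑< n (λ w → c * f w) ≡ c * ∑< n f
∑<-*ˡ zero    c f = sym (ℤP.*-zeroʳ c)
∑<-*ˡ (suc n) c f = trans (cong (_+ c * f n) (∑<-*ˡ n c f)) (sym (ℤP.*-distribˡ-+ c _ (f n)))

σ : ℕ → ℤ
σ n = -1ℤ ^ n

σ-even : ∀ n → evenᵇ n ≡ true → σ n ≡ 1ℤ
σ-even zero          _ = refl
σ-even (suc (suc n)) e = cong (λ x → -1ℤ * (-1ℤ * x)) (σ-even n e)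

σ-odd : ∀ n → evenᵇ n ≡ false → σ n ≡ -1ℤ
σ-odd (suc zero)    _ = refl
σ-odd (suc (suc n)) e = cong (λ x → -1ℤ * (-1ℤ * x)) (σ-odd n e)

σ-square : ∀ n → σ n * σ n ≡ 1ℤ
σ-square n with evenᵇ n in e
... | true  rewrite σ-even n e = refl
... | false rewrite σ-odd n e = refl

σ-+-cancelʳ : ∀ m n → σ (m ℕ.+ n) * σ n ≡ σ m
σ-+-cancelʳ m n = begin
  σ (m ℕ.+ n) * σ n   ≡⟨ cong (_* σ n) (ℤP.^-distribˡ-+-* -1ℤ m n) ⟩
  σ m * σ n * σ n     ≡⟨ ℤP.*-assoc (σ m) (σ n) (σ n) ⟩
  σ m * (σ n * σ n)   ≡⟨ cong (σ m *_) (σ-square n) ⟩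
  σ m * 1ℤ            ≡⟨ ℤP.*-identityʳ (σ m) ⟩
  σ m                 ∎
  where open ≡-Reasoning

self-negating : ∀ i → i ≡ - i → i ≡ 0ℤ
self-negating (ℤ.+ zero) _  = refl
self-negating ℤ.+[1+ n ] ()
self-negating -[1+ n ]   ()

evenᵇ-+ : ∀ m n → evenᵇ m ≡ true → evenᵇ (m ℕ.+ n) ≡ evenᵇ n
evenᵇ-+ zero          n _ = refl
evenᵇ-+ (suc (suc m)) n e = evenᵇ-+ m n e

evenᵇ-suc : ∀ n → evenᵇ n ≡ true → evenᵇ (suc n) ≡ false
evenᵇ-suc zero          _ = refl
evenᵇ-suc (suc (suc n)) e = evenᵇ-suc n e

_≡ᵇ_ : Composition → Composition → Bool
a ≡ᵇ b = does (≡-dec ℕ._≟_ a b)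

coeff-++ : ∀ X Y b → coeff (X ⊕ Y) b ≡ coeff X b + coeff Y b
coeff-++ []            Y b = sym (ℤP.+-identityˡ _)
coeff-++ ((x , a) ∷ X) Y b with ≡-dec ℕ._≟_ a b
... | yes _ = trans (cong (x +_) (coeff-++ X Y b)) (sym (ℤP.+-assoc x _ _))
... | no  _ = coeff-++ X Y b

coeff-· : ∀ c X b → coeff (c · X) b ≡ c * coeff X b
coeff-· c []            b = sym (ℤP.*-zeroʳ c)
coeff-· c ((x , a) ∷ X) b with ≡-dec ℕ._≟_ a b
... | yes _ = trans (cong (c * x +_) (coeff-· c X b)) (sym (ℤP.*-distribˡ-+ c x _))
... | no  _ = coeff-· c X b

coeff-sumFS : ∀ (f : Composition → FormalSum) xs b →
  coeff (sumFS (map f xs)) b ≡ ∑[ a ∈ xs ] coeff (f a) b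
coeff-sumFS f []       b = refl
coeff-sumFS f (a ∷ xs) b = trans (coeff-++ (f a) _ b) (cong (coeff (f a) b +_) (coeff-sumFS f xs b))

coeff-map : ∀ (g : Composition → ℤ × Composition) xs b →
  coeff (map g xs) b ≡ ∑[ a ∈ xs ] coeff (g a ∷ []) b
coeff-map g []       b = refl
coeff-map g (a ∷ xs) b = trans (coeff-++ (g a ∷ []) _ b) (cong (coeff (g a ∷ []) b +_) (coeff-map g xs b))

coeff-∷-≢ : ∀ x a X {b} → a ≢ b → coeff ((x , a) ∷ X) b ≡ coeff X b
coeff-∷-≢ x a X {b} a≢b with ≡-dec ℕ._≟_ a b
... | yes a≡b = ⊥-elim (a≢b a≡b)
... | no  _   = refl

coeff-∷-≡ : ∀ x a X → coeff ((x , a) ∷ X) a ≡ x + coeff X a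
coeff-∷-≡ x a X with ≡-dec ℕ._≟_ a a
... | yes _   = refl
... | no  a≢a = ⊥-elim (a≢a refl)

coeff-singleton-≡ : ∀ x a → coeff ((x , a) ∷ []) a ≡ x
coeff-singleton-≡ x a = trans (coeff-∷-≡ x a []) (ℤP.+-identityʳ x)

coeff-singleton-≢ : ∀ x a {b} → a ≢ b → coeff ((x , a) ∷ []) b ≡ 0ℤ
coeff-singleton-≢ x a = coeff-∷-≢ x a []

mass : (Composition → Bool) → FormalSum → ℤ
mass q []            = 0ℤ
mass q ((x , a) ∷ X) = if q a then x + mass q X else mass q X

coeff-mass : ∀ X b → coeff X b ≡ mass (_≡ᵇ b) X
coeff-mass []            b = refl
coeff-mass ((x , a) ∷ X) b with ≡-dec ℕ._≟_ a b
... | yes _ = cong (x +_) (coeff-mass X b)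
... | no  _ = coeff-mass X b

coeff-initFS-mass : ∀ X c → coeff (initFS X) c ≡ mass (λ a → init a ≡ᵇ c) X
coeff-initFS-mass []            c = refl
coeff-initFS-mass ((x , a) ∷ X) c with ≡-dec ℕ._≟_ (init a) c
... | yes _ = cong (x +_) (coeff-initFS-mass X c)
... | no  _ = coeff-initFS-mass X c

mass-cong : ∀ X {p q} → (∀ a → p a ≡ q a) → mass p X ≡ mass q X
mass-cong []                    eq = refl
mass-cong ((x , a) ∷ X) {p} {q} eq with p a | q a | eq a
... | true  | .true  | refl = cong (x +_) (mass-cong X eq)
... | false | .false | refl = mass-cong X eq

mass-split : ∀ X (q p : Composition → Bool) →
  mass q X ≡ mass (λ a → q a ∧ p a) X + mass (λ a → q a ∧ not (p a)) X
mass-split []            q p = refl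
mass-split ((x , a) ∷ X) q p with q a | p a
... | true  | true  = trans (cong (x +_) (mass-split X q p)) (sym (ℤP.+-assoc x _ _))
... | true  | false = trans (cong (x +_) (mass-split X q p)) (+-left-comm x (mass (λ b → q b ∧ p b) X) _)
  where
  +-left-comm : ∀ i j k → i + (j + k) ≡ j + (i + k)
  +-left-comm = solve 3 (λ i j k → i :+ (j :+ k) := j :+ (i :+ k)) refl
    where open +-*-Solver
... | false | _     = mass-split X q p

≡ᵇ-refl : ∀ a → (a ≡ᵇ a) ≡ true
≡ᵇ-refl a with ≡-dec ℕ._≟_ a a
... | yes _   = refl
... | no  a≢a = ⊥-elim (a≢a refl)

∧-≡ᵇ : ∀ (q : Composition → Bool) {a} → q a ≡ true → ∀ b → (q b ∧ b ≡ᵇ a) ≡ b ≡ᵇ a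
∧-≡ᵇ q {a} qa b with ≡-dec ℕ._≟_ b a
... | yes refl = trans (BoolP.∧-identityʳ (q b)) qa
... | no  _    = BoolP.∧-zeroʳ (q b)

-- Formal sums are not normalised: the entries on a single composition may cancel, so all entries
-- on the head's composition are split off together.
mass-vanishing : ∀ X q → (∀ b → q b ≡ true → coeff X b ≡ 0ℤ) → mass q X ≡ 0ℤ
mass-vanishing []            q vanish = refl
mass-vanishing ((x , a) ∷ X) q vanish with q a in qa
... | false = mass-vanishing X q λ b qb →
  trans (sym (coeff-∷-≢ x a X λ { refl → contradiction (trans (sym qa) qb) λ () })) (vanish b qb)
... | true = begin
  x + mass q X
    ≡⟨ cong (x +_) (mass-split X q (_≡ᵇ a)) ⟩
  x + (mass (λ b → q b ∧ b ≡ᵇ a) X + mass (λ b → q b ∧ not (b ≡ᵇ a)) X)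
    ≡⟨ cong₂ (λ m n → x + (m + n)) (mass-cong X (∧-≡ᵇ q qa)) (mass-vanishing X _ off-a) ⟩
  x + (mass (_≡ᵇ a) X + 0ℤ)
    ≡⟨ cong (x +_) (trans (ℤP.+-identityʳ _) (sym (coeff-mass X a))) ⟩
  x + coeff X a
    ≡⟨ sym (coeff-∷-≡ x a X) ⟩
  coeff ((x , a) ∷ X) a
    ≡⟨ vanish a qa ⟩
  0ℤ ∎
  where
  open ≡-Reasoning
  off-a : ∀ b → (q b ∧ not (b ≡ᵇ a)) ≡ true → coeff X b ≡ 0ℤ
  off-a b h with ≡-dec ℕ._≟_ b a | q b in qb
  ... | no b≢a | true = trans (sym (coeff-∷-≢ x a X (b≢a ∘ sym))) (vanish b qb)

mass-fibre : ∀ (f : Composition → Composition) X b →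
  (∀ a → coeff X a ≢ 0ℤ → f a ≡ f b → a ≡ b) →
  mass (λ a → f a ≡ᵇ f b) X ≡ coeff X b
mass-fibre f X b fibre = begin
  mass q X
    ≡⟨ mass-split X q (_≡ᵇ b) ⟩
  mass (λ a → q a ∧ a ≡ᵇ b) X + mass (λ a → q a ∧ not (a ≡ᵇ b)) X
    ≡⟨ cong₂ _+_ (mass-cong X (∧-≡ᵇ q (≡ᵇ-refl (f b)))) (mass-vanishing X _ off-b) ⟩
  mass (_≡ᵇ b) X + 0ℤ
    ≡⟨ ℤP.+-identityʳ _ ⟩
  mass (_≡ᵇ b) X
    ≡⟨ sym (coeff-mass X b) ⟩
  coeff X b ∎
  where
  open ≡-Reasoning
  q : Composition → Bool
  q a = f a ≡ᵇ f b
  off-b : ∀ a → (q a ∧ not (a ≡ᵇ b)) ≡ true → coeff X a ≡ 0ℤ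
  off-b a h with ≡-dec ℕ._≟_ (f a) (f b) | ≡-dec ℕ._≟_ a b | coeff X a ℤ.≟ 0ℤ
  ... | yes fa≡fb | no a≢b | no  ≢0 = ⊥-elim (a≢b (fibre a ≢0 fa≡fb))
  ... | _         | _      | yes ≡0 = ≡0

Positive : Composition → Set
Positive = All (1 ≤_)

admissible⇒positive : ∀ a → Admissible a → Positive a
admissible⇒positive []      _           = []
admissible⇒positive (x ∷ a) (2≤x , pos) = ℕP.<⇒≤ 2≤x ∷ pos

admissible⇒admissibleᵇ : ∀ a → Admissible a → T (admissibleᵇ a)
admissible⇒admissibleᵇ []                  _ = tt
admissible⇒admissibleᵇ (suc (suc _) ∷ _) _ = tt
admissible⇒admissibleᵇ (suc zero ∷ _)    (s≤s () , _)

admissibleᵇ⇒admissible : ∀ a → T (admissibleᵇ a) → Positive a → Admissible a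
admissibleᵇ⇒admissible []                  _ _         = tt
admissibleᵇ⇒admissible (suc (suc _) ∷ _) _ (_ ∷ pos) = s≤s (s≤s z≤n) , pos

init-admissible : ∀ a → Admissible a → Admissible (init a)
init-admissible []          _           = tt
init-admissible (x ∷ [])    _           = tt
init-admissible (x ∷ y ∷ a) (2≤x , pos) = 2≤x , init-positive (y ∷ a) pos
  where
  init-positive : ∀ a → Positive a → Positive (init a)
  init-positive []          _          = []
  init-positive (x ∷ [])    _          = []
  init-positive (x ∷ y ∷ a) (px ∷ pos) = px ∷ init-positive (y ∷ a) pos

∷ʳ-admissible : ∀ a j → Admissible a → 1 ≤ j → (a ≡ [] → 2 ≤ j) → Admissible (a ∷ʳ j)
∷ʳ-admissible []      j _           _   2≤j = 2≤j refl , []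
∷ʳ-admissible (x ∷ a) j (2≤x , pos) 1≤j _   = 2≤x , AllP.++⁺ pos (1≤j ∷ [])

init-∷ʳ : ∀ a j → init (a ∷ʳ j) ≡ a
init-∷ʳ []          j = refl
init-∷ʳ (x ∷ [])    j = refl
init-∷ʳ (x ∷ y ∷ a) j = cong (x ∷_) (init-∷ʳ (y ∷ a) j)

weight-∷ʳ : ∀ a j → weight (a ∷ʳ j) ≡ weight a ℕ.+ j
weight-∷ʳ a j = trans (sum-++ a (j ∷ [])) (cong (weight a ℕ.+_) (ℕP.+-identityʳ j))

depth-∷ʳ : ∀ a j → depth (a ∷ʳ j) ≡ suc (depth a)
depth-∷ʳ a j = trans (ListP.length-++ a) (ℕP.+-comm (depth a) 1)

init-injective : ∀ a b → 0 < weight a → weight a ≡ weight b → init a ≡ init b → a ≡ b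
init-injective a b 0<wa wa≡wb ia≡ib with initLast a | initLast b
... | []       | _        = contradiction 0<wa λ ()
... | u ∷ʳ′ j | []       = contradiction (subst (0 <_) wa≡wb 0<wa) λ ()
... | u ∷ʳ′ j | v ∷ʳ′ i
  with refl ← trans (sym (init-∷ʳ u j)) (trans ia≡ib (init-∷ʳ v i))
  = cong (u ∷ʳ_) (ℕP.+-cancelˡ-≡ (weight u) j i
      (trans (sym (weight-∷ʳ u j)) (trans wa≡wb (weight-∷ʳ u i))))

compositions-sound : ∀ n {a} → a ∈ compositions n → Positive a × weight a ≡ n
compositions-sound zero    (here refl) = [] , refl
compositions-sound (suc n) a∈ with ∈P.∈-++⁻ (map (1 ∷_) (compositions n)) a∈
... | inj₁ a∈₁ with ∈P.∈-map⁻ (1 ∷_) a∈₁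
...   | r , r∈ , refl with compositions-sound n r∈
...     | pos , wr = s≤s z≤n ∷ pos , cong suc wr
compositions-sound (suc n) a∈ | inj₂ a∈₂ with ∈P.∈-map⁻ bump a∈₂
... | r , r∈ , refl with ∈P.∈-filter⁻ (T? ∘ nonEmpty) {xs = compositions n} r∈
...   | r∈′ , _ with r | compositions-sound n r∈′
...     | x ∷ r′ | (_ ∷ pos) , wr = s≤s z≤n ∷ pos , cong suc wr

compositions-complete : ∀ n a → Positive a → weight a ≡ n → a ∈ compositions n
compositions-complete zero    []                  _         _  = here refl
compositions-complete zero    (suc _ ∷ _)         _         ()
compositions-complete n       (zero ∷ _)          (() ∷ _)  _
compositions-complete (suc n) (suc zero ∷ a)      (_ ∷ pos) wa =
  ∈P.∈-++⁺ˡ (∈P.∈-map⁺ (1 ∷_) (compositions-complete n a pos (ℕP.suc-injective wa)))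
compositions-complete (suc n) (suc (suc x) ∷ a)   (_ ∷ pos) wa =
  ∈P.∈-++⁺ʳ (map (1 ∷_) (compositions n)) (∈P.∈-map⁺ bump (∈P.∈-filter⁺ (T? ∘ nonEmpty)
    (compositions-complete n (suc x ∷ a) (s≤s z≤n ∷ pos) (ℕP.suc-injective wa)) tt))

compositions-unique : ∀ n → Unique (compositions n)
compositions-unique zero    = [] ∷ []
compositions-unique (suc n) = UniqueP.++⁺
  (UniqueP.map⁺ (λ { refl → refl }) (compositions-unique n))
  (UniqueP.map⁺ bump-injective (UniqueP.filter⁺ (T? ∘ nonEmpty) (compositions-unique n)))
  λ (a∈₁ , a∈₂) → starts-differently a∈₁ a∈₂
  where
  bump-injective : ∀ {a b} → bump a ≡ bump b → a ≡ b
  bump-injective {[]}    {[]}    _    = refl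
  bump-injective {_ ∷ _} {_ ∷ _} refl = refl
  starts-differently : ∀ {a} → a ∈ map (1 ∷_) (compositions n) →
    ¬ a ∈ map bump (filterᵇ nonEmpty (compositions n))
  starts-differently a∈₁ a∈₂ with ∈P.∈-map⁻ (1 ∷_) a∈₁ | ∈P.∈-map⁻ bump a∈₂
  ... | _ , _ , refl | r , r∈ , e with ∈P.∈-filter⁻ (T? ∘ nonEmpty) {xs = compositions n} r∈
  ...   | r∈′ , _ with r | compositions-sound n r∈′ | e
  ...     | zero ∷ _ | (() ∷ _) , _ | _

𝒜-sound : ∀ k {a} → a ∈ 𝒜 k → Admissible a × weight a ≡ k
𝒜-sound k {a} a∈ with ∈P.∈-filter⁻ (T? ∘ admissibleᵇ) {xs = compositions k} a∈
... | a∈′ , adm with compositions-sound k a∈′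
...   | pos , wa = admissibleᵇ⇒admissible a adm pos , wa

𝒜-complete : ∀ k {a} → Admissible a → weight a ≡ k → a ∈ 𝒜 k
𝒜-complete k {a} adm wa = ∈P.∈-filter⁺ (T? ∘ admissibleᵇ)
  (compositions-complete k a (admissible⇒positive a adm) wa) (admissible⇒admissibleᵇ a adm)

𝒜-unique : ∀ k → Unique (𝒜 k)
𝒜-unique k = UniqueP.filter⁺ (T? ∘ admissibleᵇ) (compositions-unique k)

↭-𝒜 : ∀ k {xs} → Unique xs → (∀ {a} → a ∈ xs → Admissible a × weight a ≡ k) →
  (∀ {a} → Admissible a → weight a ≡ k → a ∈ xs) → xs ↭ 𝒜 k
↭-𝒜 k uniq sound complete = ∼bag⇒↭ (unique∧set⇒bag uniq (𝒜-unique k) (mk⇔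
  (λ a∈ → let adm , wa = sound a∈ in 𝒜-complete k adm wa)
  (λ a∈ → let adm , wa = 𝒜-sound k a∈ in complete adm wa)))

-- The block of zeros in Defs.word is a local function that cannot be named; the meta below is
-- solved to it by unification (inside a mutual block, so that it is not frozen beforehand).
mutual
  zeros : ℕ → List ℕ → ℕ → List Bool
  zeros = _

  word-∷-zeros : ∀ x a → word (x ∷ a) ≡ zeros x a (x ∸ 1) ++ true ∷ word a
  word-∷-zeros x a with x ∸ 1
  ... | m = refl

zeros-replicate : ∀ x a m → zeros x a m ≡ replicate m false
zeros-replicate x a zero    = refl
zeros-replicate x a (suc m) = cong (false ∷_) (zeros-replicate x a m)

word-∷ : ∀ x a → word (x ∷ a) ≡ replicate (x ∸ 1) false ++ true ∷ word a
word-∷ x a = trans (word-∷-zeros x a) (cong (_++ true ∷ word a) (zeros-replicate x a (x ∸ 1)))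

ones : List Bool → ℕ
ones []          = 0
ones (true ∷ w)  = suc (ones w)
ones (false ∷ w) = ones w

ones-++ : ∀ u v → ones (u ++ v) ≡ ones u ℕ.+ ones v
ones-++ []          v = refl
ones-++ (true ∷ u)  v = cong suc (ones-++ u v)
ones-++ (false ∷ u) v = ones-++ u v

ones-zeros : ∀ n → ones (replicate n false) ≡ 0
ones-zeros zero    = refl
ones-zeros (suc n) = ones-zeros n

ones-reverse : ∀ w → ones (reverse w) ≡ ones w
ones-reverse []      = refl
ones-reverse (x ∷ w) = begin
  ones (reverse (x ∷ w))      ≡⟨ cong ones (ListP.unfold-reverse x w) ⟩
  ones (reverse w ∷ʳ x)       ≡⟨ ones-++ (reverse w) (x ∷ []) ⟩
  ones (reverse w) ℕ.+ ones (x ∷ [])  ≡⟨ cong (ℕ._+ ones (x ∷ [])) (ones-reverse w) ⟩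
  ones w ℕ.+ ones (x ∷ [])    ≡⟨ ℕP.+-comm (ones w) _ ⟩
  ones (x ∷ []) ℕ.+ ones w    ≡⟨ ones-++ (x ∷ []) w ⟨
  ones (x ∷ w)                ∎
  where open ≡-Reasoning

ones-not : ∀ w → ones (map not w) ℕ.+ ones w ≡ length w
ones-not []          = refl
ones-not (true ∷ w)  = trans (ℕP.+-suc _ _) (cong suc (ones-not w))
ones-not (false ∷ w) = cong suc (ones-not w)

ones-word : ∀ a → ones (word a) ≡ depth a
ones-word []      = refl
ones-word (x ∷ a) = begin
  ones (word (x ∷ a))                                   ≡⟨ cong ones (word-∷ x a) ⟩
  ones (replicate (x ∸ 1) false ++ true ∷ word a)       ≡⟨ ones-++ (replicate (x ∸ 1) false) _ ⟩
  ones (replicate (x ∸ 1) false) ℕ.+ suc (ones (word a)) ≡⟨ cong₂ (λ m n → m ℕ.+ suc n) (ones-zeros (x ∸ 1)) (ones-word a) ⟩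
  suc (depth a)                                         ∎
  where open ≡-Reasoning

length-word : ∀ a → Positive a → length (word a) ≡ weight a
length-word []          _         = refl
length-word (suc x ∷ a) (_ ∷ pos) = begin
  length (word (suc x ∷ a))                          ≡⟨ cong length (word-∷ (suc x) a) ⟩
  length (replicate x false ++ true ∷ word a)        ≡⟨ ListP.length-++ (replicate x false) ⟩
  length (replicate x false) ℕ.+ suc (length (word a)) ≡⟨ cong₂ (λ m n → m ℕ.+ suc n) (ListP.length-replicate x) (length-word a pos) ⟩
  x ℕ.+ suc (weight a)                               ≡⟨ ℕP.+-suc x (weight a) ⟩
  weight (suc x ∷ a)                                 ∎
  where open ≡-Reasoning

fromWord′-zeros : ∀ acc n w → fromWord′ acc (replicate n false ++ w) ≡ fromWord′ (acc ℕ.+ n) w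
fromWord′-zeros acc zero    w = cong (λ m → fromWord′ m w) (sym (ℕP.+-identityʳ acc))
fromWord′-zeros acc (suc n) w = trans (fromWord′-zeros (suc acc) n w) (cong (λ m → fromWord′ m w) (sym (ℕP.+-suc acc n)))

fromWord-word : ∀ a → Positive a → fromWord (word a) ≡ a
fromWord-word []          _         = refl
fromWord-word (suc x ∷ a) (_ ∷ pos) = begin
  fromWord (word (suc x ∷ a))                     ≡⟨ cong fromWord (word-∷ (suc x) a) ⟩
  fromWord′ 0 (replicate x false ++ true ∷ word a) ≡⟨ fromWord′-zeros 0 x (true ∷ word a) ⟩
  suc x ∷ fromWord (word a)                       ≡⟨ cong (suc x ∷_) (fromWord-word a pos) ⟩
  suc x ∷ a                                       ∎
  where open ≡-Reasoning

word-fromWord′ : ∀ acc u → word (fromWord′ acc (u ∷ʳ true)) ≡ replicate acc false ++ u ∷ʳ true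
word-fromWord′ acc []          = word-∷ (suc acc) []
word-fromWord′ acc (true ∷ u)  = trans (word-∷ (suc acc) (fromWord′ 0 (u ∷ʳ true)))
  (cong (λ w → replicate acc false ++ true ∷ w) (word-fromWord′ 0 u))
word-fromWord′ acc (false ∷ u) = trans (word-fromWord′ (suc acc) u) (replicate-suc-++ acc (u ∷ʳ true))
  where
  replicate-suc-++ : ∀ n v → replicate (suc n) false ++ v ≡ replicate n false ++ false ∷ v
  replicate-suc-++ zero    v = refl
  replicate-suc-++ (suc n) v = cong (false ∷_) (replicate-suc-++ n v)

positive-fromWord′ : ∀ acc w → Positive (fromWord′ acc w)
positive-fromWord′ acc []          = []
positive-fromWord′ acc (true ∷ w)  = s≤s z≤n ∷ positive-fromWord′ 0 w
positive-fromWord′ acc (false ∷ w) = positive-fromWord′ (suc acc) w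

admissible-fromWord′ : ∀ acc w → Admissible (fromWord′ (suc acc) w)
admissible-fromWord′ acc []          = tt
admissible-fromWord′ acc (true ∷ w)  = s≤s (s≤s z≤n) , positive-fromWord′ 0 w
admissible-fromWord′ acc (false ∷ w) = admissible-fromWord′ (suc acc) w

word-ends-with-one : ∀ x a → ∃ λ u → word (x ∷ a) ≡ u ∷ʳ true
word-ends-with-one x []      = replicate (x ∸ 1) false , word-∷ x []
word-ends-with-one x (y ∷ a) with word-ends-with-one y a
... | u , wya≡ = replicate (x ∸ 1) false ++ true ∷ u ,
  trans (word-∷ x (y ∷ a)) (trans (cong (λ w → replicate (x ∸ 1) false ++ true ∷ w) wya≡)
    (sym (ListP.++-assoc (replicate (x ∸ 1) false) (true ∷ u) (true ∷ []))))

word-starts-with-zero : ∀ x a → 2 ≤ x → ∃ λ v → word (x ∷ a) ≡ false ∷ v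
word-starts-with-zero (suc (suc x)) a _         = replicate x false ++ true ∷ word a , word-∷ (suc (suc x)) a
word-starts-with-zero (suc zero)    a (s≤s ())

dualWord-involutive : ∀ w → dualWord (dualWord w) ≡ w
dualWord-involutive w = begin
  reverse (map not (reverse (map not w))) ≡⟨ cong reverse (ListP.reverse-map not (map not w)) ⟩
  reverse (reverse (map not (map not w))) ≡⟨ ListP.reverse-involutive _ ⟩
  map not (map not w)                     ≡⟨ ListP.map-∘ w ⟨
  map (not ∘ not) w                       ≡⟨ ListP.map-cong BoolP.not-involutive w ⟩
  map (λ b → b) w                         ≡⟨ ListP.map-id w ⟩
  w                                       ∎
  where open ≡-Reasoning

dualWord-∷ʳ : ∀ u → dualWord (u ∷ʳ true) ≡ false ∷ dualWord u
dualWord-∷ʳ u = trans (cong reverse (ListP.map-++ not u (true ∷ []))) (ListP.reverse-++ (map not u) (false ∷ []))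

dualWord-∷ : ∀ v → dualWord (false ∷ v) ≡ dualWord v ∷ʳ true
dualWord-∷ v = ListP.unfold-reverse true (map not v)

length-dualWord : ∀ w → length (dualWord w) ≡ length w
length-dualWord w = trans (ListP.length-reverse (map not w)) (ListP.length-map not w)

ones-dualWord : ∀ w → ones (dualWord w) ℕ.+ ones w ≡ length w
ones-dualWord w = trans (cong (ℕ._+ ones w) (ones-reverse (map not w))) (ones-not w)

word-dual : ∀ a → Admissible a → word (dual a) ≡ dualWord (word a)
word-dual []      _         = refl
word-dual (x ∷ a) (2≤x , _) with word-starts-with-zero x a 2≤x
... | v , wxa≡ = begin
  word (fromWord (dualWord (word (x ∷ a))))  ≡⟨ cong (word ∘ fromWord) dual≡ ⟩
  word (fromWord (dualWord v ∷ʳ true))       ≡⟨ word-fromWord′ 0 (dualWord v) ⟩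
  dualWord v ∷ʳ true                         ≡⟨ dual≡ ⟨
  dualWord (word (x ∷ a))                    ∎
  where
  open ≡-Reasoning
  dual≡ : dualWord (word (x ∷ a)) ≡ dualWord v ∷ʳ true
  dual≡ = trans (cong dualWord wxa≡) (dualWord-∷ v)

dual-involutive : ∀ a → Admissible a → dual (dual a) ≡ a
dual-involutive a adm = begin
  fromWord (dualWord (word (dual a)))      ≡⟨ cong (fromWord ∘ dualWord) (word-dual a adm) ⟩
  fromWord (dualWord (dualWord (word a)))  ≡⟨ cong fromWord (dualWord-involutive (word a)) ⟩
  fromWord (word a)                        ≡⟨ fromWord-word a (admissible⇒positive a adm) ⟩
  a                                        ∎
  where open ≡-Reasoning

dual-admissible : ∀ a → Admissible a → Admissible (dual a)
dual-admissible []      _ = tt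
dual-admissible (x ∷ a) _ with word-ends-with-one x a
... | u , wxa≡ = subst (Admissible ∘ fromWord) (sym (trans (cong dualWord wxa≡) (dualWord-∷ʳ u)))
  (admissible-fromWord′ 0 (dualWord u))

weight-dual : ∀ a → Admissible a → weight (dual a) ≡ weight a
weight-dual a adm = begin
  weight (dual a)           ≡⟨ length-word (dual a) (admissible⇒positive _ (dual-admissible a adm)) ⟨
  length (word (dual a))    ≡⟨ cong length (word-dual a adm) ⟩
  length (dualWord (word a)) ≡⟨ length-dualWord (word a) ⟩
  length (word a)           ≡⟨ length-word a (admissible⇒positive a adm) ⟩
  weight a                  ∎
  where open ≡-Reasoning

depth-dual : ∀ a → Admissible a → depth (dual a) ℕ.+ depth a ≡ weight a
depth-dual a adm = begin
  depth (dual a) ℕ.+ depth a                   ≡⟨ cong₂ ℕ._+_ (ones-word (dual a)) (ones-word a) ⟨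
  ones (word (dual a)) ℕ.+ ones (word a)       ≡⟨ cong (λ w → ones w ℕ.+ ones (word a)) (word-dual a adm) ⟩
  ones (dualWord (word a)) ℕ.+ ones (word a)   ≡⟨ ones-dualWord (word a) ⟩
  length (word a)                              ≡⟨ length-word a (admissible⇒positive a adm) ⟩
  weight a                                     ∎
  where open ≡-Reasoning

∑-𝒜-dual : ∀ k h → ∑[ a ∈ 𝒜 k ] h (dual a) ≡ ∑ (𝒜 k) h
∑-𝒜-dual k h = trans (sym (∑-map dual (𝒜 k) h)) (∑-↭ h (↭-𝒜 k unique sound complete))
  where
  unique : Unique (map dual (𝒜 k))
  unique = Unique-map⁺ dual (λ {a} {b} a∈ b∈ da≡db → begin
    a               ≡⟨ dual-involutive a (proj₁ (𝒜-sound k a∈)) ⟨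
    dual (dual a)   ≡⟨ cong dual da≡db ⟩
    dual (dual b)   ≡⟨ dual-involutive b (proj₁ (𝒜-sound k b∈)) ⟩
    b               ∎) (𝒜-unique k)
    where open ≡-Reasoning
  sound : ∀ {a} → a ∈ map dual (𝒜 k) → Admissible a × weight a ≡ k
  sound a∈ with ∈P.∈-map⁻ dual a∈
  ... | b , b∈ , refl with 𝒜-sound k b∈
  ...   | adm , wb = dual-admissible b adm , trans (weight-dual b adm) wb
  complete : ∀ {a} → Admissible a → weight a ≡ k → a ∈ map dual (𝒜 k)
  complete {a} adm wa = subst (_∈ map dual (𝒜 k)) (dual-involutive a adm)
    (∈P.∈-map⁺ dual (𝒜-complete k (dual-admissible a adm) (trans (weight-dual a adm) wa)))

splitLast : ℕ → ℕ → List Composition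
splitLast k zero    = []
splitLast k (suc n) = splitLast k n ++ map (_∷ʳ (k ∸ n)) (𝒜 n)

∑-splitLast : ∀ k n h → ∑ (splitLast k n) h ≡ ∑< n (λ w → ∑[ b ∈ 𝒜 w ] h (b ∷ʳ (k ∸ w)))
∑-splitLast k zero    h = refl
∑-splitLast k (suc n) h = trans (∑-++ (splitLast k n) _ h)
  (cong₂ _+_ (∑-splitLast k n h) (∑-map (_∷ʳ (k ∸ n)) (𝒜 n) h))

∈-splitLast⁻ : ∀ k n {a} → a ∈ splitLast k n → ∃ λ w → w < n × ∃ λ b → b ∈ 𝒜 w × a ≡ b ∷ʳ (k ∸ w)
∈-splitLast⁻ k (suc n) a∈ with ∈P.∈-++⁻ (splitLast k n) a∈
... | inj₁ a∈₁ with ∈-splitLast⁻ k n a∈₁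
...   | w , w<n , b , b∈ , a≡ = w , ℕP.m<n⇒m<1+n w<n , b , b∈ , a≡
∈-splitLast⁻ k (suc n) a∈ | inj₂ a∈₂ with ∈P.∈-map⁻ (_∷ʳ (k ∸ n)) a∈₂
... | b , b∈ , a≡ = n , ℕP.n<1+n n , b , b∈ , a≡

∈-splitLast⁺ : ∀ k n {w b} → w < n → b ∈ 𝒜 w → b ∷ʳ (k ∸ w) ∈ splitLast k n
∈-splitLast⁺ k (suc n) {w} w<1+n b∈ with ℕP.m≤n⇒m<n∨m≡n (ℕP.≤-pred w<1+n)
... | inj₁ w<n  = ∈P.∈-++⁺ˡ (∈-splitLast⁺ k n w<n b∈)
... | inj₂ refl = ∈P.∈-++⁺ʳ (splitLast k n) (∈P.∈-map⁺ (_∷ʳ (k ∸ w)) b∈)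

splitLast-unique : ∀ k n → Unique (splitLast k n)
splitLast-unique k zero    = []
splitLast-unique k (suc n) = UniqueP.++⁺ (splitLast-unique k n)
  (UniqueP.map⁺ (ListP.∷ʳ-injectiveˡ _ _) (𝒜-unique n))
  λ (a∈₁ , a∈₂) → disjoint a∈₁ a∈₂
  where
  disjoint : ∀ {a} → a ∈ splitLast k n → ¬ a ∈ map (_∷ʳ (k ∸ n)) (𝒜 n)
  disjoint a∈₁ a∈₂ with ∈-splitLast⁻ k n a∈₁ | ∈P.∈-map⁻ (_∷ʳ (k ∸ n)) a∈₂
  ... | w , w<n , b , b∈ , refl | b′ , b′∈ , e with refl ← ListP.∷ʳ-injectiveˡ b b′ e =
    ℕP.<-irrefl (trans (sym (proj₂ (𝒜-sound w b∈))) (proj₂ (𝒜-sound n b′∈))) w<n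

splitLast-↭ : ∀ k → 2 ≤ k → splitLast k k ↭ 𝒜 k
splitLast-↭ k 2≤k = ↭-𝒜 k (splitLast-unique k k) sound complete
  where
  sound : ∀ {a} → a ∈ splitLast k k → Admissible a × weight a ≡ k
  sound a∈ with ∈-splitLast⁻ k k a∈
  ... | w , w<k , b , b∈ , refl with 𝒜-sound w b∈
  ...   | adm , refl = ∷ʳ-admissible b (k ∸ w) adm (ℕP.m<n⇒0<n∸m w<k) (λ { refl → 2≤k })
                     , trans (weight-∷ʳ b (k ∸ w)) (ℕP.m+[n∸m]≡n (ℕP.<⇒≤ w<k))
  complete : ∀ {a} → Admissible a → weight a ≡ k → a ∈ splitLast k k
  complete {a} adm wa with initLast a
  ... | []       = contradiction (subst (2 ≤_) (sym wa) 2≤k) λ ()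
  ... | u ∷ʳ′ j = subst (λ i → u ∷ʳ i ∈ splitLast k k) k∸wu≡j
    (∈-splitLast⁺ k k wu<k (𝒜-complete (weight u) (subst Admissible (init-∷ʳ u j) (init-admissible _ adm)) refl))
    where
    1≤j : 1 ≤ j
    1≤j with AllP.++⁻ʳ u (admissible⇒positive _ adm)
    ... | 1≤j ∷ [] = 1≤j
    wu+j≡k : weight u ℕ.+ j ≡ k
    wu+j≡k = trans (sym (weight-∷ʳ u j)) wa
    wu<k : weight u < k
    wu<k = subst (weight u <_) wu+j≡k (ℕP.m<m+n (weight u) 1≤j)
    k∸wu≡j : k ∸ weight u ≡ j
    k∸wu≡j = trans (cong (_∸ weight u) (sym wu+j≡k)) (ℕP.m+n∸m≡n (weight u) j)

∑-𝒜-∷ʳ : ∀ k → 2 ≤ k → ∀ h → ∑ (𝒜 k) h ≡ ∑< k (λ w → ∑[ b ∈ 𝒜 w ] h (b ∷ʳ (k ∸ w)))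
∑-𝒜-∷ʳ k 2≤k h = trans (∑-↭ h (↭-sym (splitLast-↭ k 2≤k))) (∑-splitLast k k h)

sign : Composition → ℤ
sign a = σ (depth a)

sign-∷ʳ : ∀ a j → sign (a ∷ʳ j) ≡ - sign a
sign-∷ʳ a j = trans (cong σ (depth-∷ʳ a j)) (ℤP.-1*i≡-i (sign a))

sign-dual : ∀ a → Admissible a → sign (dual a) ≡ σ (weight a) * sign a
sign-dual a adm = sym (trans (cong (λ n → σ n * sign a) (sym (depth-dual a adm)))
  (σ-+-cancelʳ (depth (dual a)) (depth a)))

signedSum : ℕ → (Composition → ℤ) → ℤ
signedSum k g = ∑[ a ∈ 𝒜 k ] (sign a * g a)

signedSum-cong : ∀ k {f g} → (∀ {a} → a ∈ 𝒜 k → f a ≡ g a) → signedSum k f ≡ signedSum k g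
signedSum-cong k eq = ∑-cong (𝒜 k) (λ {a} a∈ → cong (sign a *_) (eq a∈))

signedSum-+ : ∀ k f g → signedSum k (λ a → f a + g a) ≡ signedSum k f + signedSum k g
signedSum-+ k f g = trans (∑-cong (𝒜 k) (λ {a} _ → ℤP.*-distribˡ-+ (sign a) (f a) (g a)))
  (∑-+ (𝒜 k) (λ a → sign a * f a) (λ a → sign a * g a))

signedSum-dual : ∀ k g → signedSum k (g ∘ dual) ≡ σ k * signedSum k g
signedSum-dual k g = begin
  ∑[ a ∈ 𝒜 k ] (sign a * g (dual a))
    ≡⟨ ∑-𝒜-dual k (λ a → sign a * g (dual a)) ⟨
  ∑[ a ∈ 𝒜 k ] (sign (dual a) * g (dual (dual a)))
    ≡⟨ ∑-cong (𝒜 k) dualise ⟩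
  ∑[ a ∈ 𝒜 k ] (σ k * (sign a * g a))
    ≡⟨ ∑-*ˡ (𝒜 k) (σ k) (λ a → sign a * g a) ⟩
  σ k * signedSum k g ∎
  where
  open ≡-Reasoning
  dualise : ∀ {a} → a ∈ 𝒜 k → sign (dual a) * g (dual (dual a)) ≡ σ k * (sign a * g a)
  dualise {a} a∈ with 𝒜-sound k a∈
  ... | adm , refl = trans (cong₂ _*_ (sign-dual a adm) (cong g (dual-involutive a adm)))
                           (ℤP.*-assoc (σ (weight a)) (sign a) (g a))

signedSum-init : ∀ k → 2 ≤ k → ∀ g → signedSum k (g ∘ init) ≡ - ∑< k (λ w → signedSum w g)
signedSum-init k 2≤k g = begin
  signedSum k (g ∘ init)
    ≡⟨ ∑-𝒜-∷ʳ k 2≤k (λ a → sign a * g (init a)) ⟩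
  ∑< k (λ w → ∑[ b ∈ 𝒜 w ] (sign (b ∷ʳ (k ∸ w)) * g (init (b ∷ʳ (k ∸ w)))))
    ≡⟨ ∑<-cong k (λ {w} _ → ∑-cong (𝒜 w) λ {b} _ → drop-last b (k ∸ w)) ⟩
  ∑< k (λ w → ∑[ b ∈ 𝒜 w ] (- (sign b * g b)))
    ≡⟨ ∑<-cong k (λ {w} _ → trans (∑-neg (𝒜 w) _) (sym (ℤP.-1*i≡-i _))) ⟩
  ∑< k (λ w → -1ℤ * signedSum w g)
    ≡⟨ ∑<-*ˡ k -1ℤ _ ⟩
  -1ℤ * ∑< k (λ w → signedSum w g)
    ≡⟨ ℤP.-1*i≡-i _ ⟩
  - ∑< k (λ w → signedSum w g) ∎
  where
  open ≡-Reasoning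
  drop-last : ∀ b j → sign (b ∷ʳ j) * g (init (b ∷ʳ j)) ≡ - (sign b * g b)
  drop-last b j = trans (cong₂ _*_ (sign-∷ʳ b j) (cong g (init-∷ʳ b j))) (sym (ℤP.neg-distribˡ-* (sign b) (g b)))

signedSum-fin : ∀ k g → evenᵇ k ≡ true → (∀ a → Admissible a → g (dual a) ≡ g a) →
  signedSum k (g ∘ fin) ≡ signedSum k (g ∘ init)
signedSum-fin k g e g-dual = begin
  signedSum k (g ∘ fin)
    ≡⟨ signedSum-cong k (λ a∈ → g-dual _ (init-admissible _ (dual-admissible _ (proj₁ (𝒜-sound k a∈))))) ⟩
  signedSum k (g ∘ init ∘ dual)      ≡⟨ signedSum-dual k (g ∘ init) ⟩
  σ k * signedSum k (g ∘ init)       ≡⟨ cong (_* signedSum k (g ∘ init)) (σ-even k e) ⟩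
  1ℤ * signedSum k (g ∘ init)        ≡⟨ ℤP.*-identityˡ _ ⟩
  signedSum k (g ∘ init)             ∎
  where open ≡-Reasoning

-- mid a = init (dual (init (dual a))) definitionally.
signedSum-mid : ∀ k g → 2 ≤ k → evenᵇ k ≡ true →
  signedSum k (g ∘ mid) ≡ - ∑< k (λ w → signedSum w (g ∘ init ∘ dual))
signedSum-mid k g 2≤k e = begin
  signedSum k (g ∘ init ∘ dual ∘ init ∘ dual)    ≡⟨ signedSum-dual k (g ∘ init ∘ dual ∘ init) ⟩
  σ k * signedSum k (g ∘ init ∘ dual ∘ init)     ≡⟨ cong₂ _*_ (σ-even k e) (signedSum-init k 2≤k (g ∘ init ∘ dual)) ⟩
  1ℤ * - ∑< k (λ w → signedSum w (g ∘ init ∘ dual)) ≡⟨ ℤP.*-identityˡ _ ⟩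
  - ∑< k (λ w → signedSum w (g ∘ init ∘ dual))   ∎
  where open ≡-Reasoning

-- In the sum over w of σ w · (−∑_{u<w} T u), consecutive terms w = n, n + 1 (n even) add up to T n.
∑<-alternating : ∀ (T R : ℕ → ℤ) → (∀ u → evenᵇ u ≡ false → T u ≡ 0ℤ) →
  R 0 ≡ T 0 → R 1 ≡ 0ℤ → (∀ w → 2 ≤ w → R w ≡ σ w * - ∑< w T) →
  ∀ k → evenᵇ k ≡ true → ∑< k R ≡ ∑< k T
∑<-alternating T R T-odd R0 R1 R≥2 zero             _ = refl
∑<-alternating T R T-odd R0 R1 R≥2 (suc (suc zero)) _ =
  cong₂ _+_ (cong (0ℤ +_) R0) (trans R1 (sym (T-odd 1 refl)))
∑<-alternating T R T-odd R0 R1 R≥2 (suc (suc n@(suc (suc _)))) e = begin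
  ∑< n R + R n + R (suc n)
    ≡⟨ cong₂ _+_ (cong₂ _+_ (∑<-alternating T R T-odd R0 R1 R≥2 n e) (R≥2 n (s≤s (s≤s z≤n))))
                 (R≥2 (suc n) (s≤s (s≤s z≤n))) ⟩
  S + σ n * - S + -1ℤ * σ n * - (S + T n)
    ≡⟨ cong (λ x → S + x * - S + -1ℤ * x * - (S + T n)) (σ-even n e) ⟩
  S + 1ℤ * - S + -1ℤ * - (S + T n)
    ≡⟨ solve 2 (λ s t → s :+ con 1ℤ :* (:- s) :+ con -1ℤ :* (:- (s :+ t)) := s :+ t :+ con 0ℤ) refl S (T n) ⟩
  S + T n + 0ℤ
    ≡⟨ cong (S + T n +_) (T-odd (suc n) (evenᵇ-suc n e)) ⟨
  S + T n + T (suc n) ∎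
  where
  open ≡-Reasoning
  open +-*-Solver
  S = ∑< n T

record Recursion (f : ℕ → Composition → ℤ) : Set where
  field
    base       : ∀ c → f 0 c ≡ coeff (basis []) c
    odd        : ∀ k c → evenᵇ k ≡ false → f k c ≡ 0ℤ
    off-weight : ∀ k c → weight c ≢ k → f k c ≡ 0ℤ
    step       : ∀ k c → evenᵇ k ≡ true → weight c ≡ suc (suc k) →
                 f (suc (suc k)) c ≡ -[1+ 2 ] * ∑< (suc (suc k)) (λ u → f u (init c))

Recursion-unique : ∀ {f g} → Recursion f → Recursion g → ∀ k c → f k c ≡ g k c
Recursion-unique {f} {g} F G = <-rec (λ k → ∀ c → f k c ≡ g k c) induct
  where
  module F = Recursion F
  module G = Recursion G
  induct : ∀ k → (∀ {u} → u < k → ∀ c → f u c ≡ g u c) → ∀ c → f k c ≡ g k c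
  induct zero             _  c = trans (F.base c) (sym (G.base c))
  induct (suc zero)       _  c = trans (F.odd 1 c refl) (sym (G.odd 1 c refl))
  induct (suc (suc k)) ih c with evenᵇ k in e
  ... | false = trans (F.odd (suc (suc k)) c e) (sym (G.odd (suc (suc k)) c e))
  ... | true with weight c ℕ.≟ suc (suc k)
  ...   | no  wc≢ = trans (F.off-weight _ c wc≢) (sym (G.off-weight _ c wc≢))
  ...   | yes wc≡ = trans (F.step k c e wc≡)
    (trans (cong (-[1+ 2 ] *_) (∑<-cong _ λ u< → ih u< (init c))) (sym (G.step k c e wc≡)))

module _ (δ : Composition → FormalSum)
         (δ-dual : ∀ a → Admissible a → δ (dual a) ≈ δ a)
         (δ-support : ∀ a → Admissible a → ∀ b → coeff (δ a) b ≢ 0ℤ →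
           Admissible b × weight b ≡ weight a)
         (δ-empty : δ [] ≈ basis [])
         (δ-init : ∀ a → Admissible a → a ≢ [] →
           initFS (δ a) ≈ δ (init a) ⊕ δ (mid a) ⊕ δ (fin a))
  where

  lhs : ℕ → Composition → ℤ
  lhs k c = signedSum k (λ a → coeff (δ a) c)

  -- δ a is homogeneous of weight (weight a), and init is injective on compositions of a fixed
  -- positive weight, so the coefficients of δ a can be read off from (δ a)^init.
  coeff-δ : ∀ a → Admissible a → ∀ b → 0 < weight b → weight b ≡ weight a →
    coeff (δ a) b ≡ coeff (δ (init a)) (init b) + coeff (δ (mid a)) (init b) + coeff (δ (fin a)) (init b)
  coeff-δ a adm b 0<wb wb≡wa = begin
    coeff (δ a) b
      ≡⟨ mass-fibre init (δ a) b fibre ⟨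
    mass (λ a′ → init a′ ≡ᵇ init b) (δ a)
      ≡⟨ coeff-initFS-mass (δ a) (init b) ⟨
    coeff (initFS (δ a)) (init b)
      ≡⟨ δ-init a adm a≢[] (init b) ⟩
    coeff (δ (init a) ⊕ δ (mid a) ⊕ δ (fin a)) (init b)
      ≡⟨ coeff-++ (δ (init a) ⊕ δ (mid a)) (δ (fin a)) (init b) ⟩
    coeff (δ (init a) ⊕ δ (mid a)) (init b) + coeff (δ (fin a)) (init b)
      ≡⟨ cong (_+ coeff (δ (fin a)) (init b)) (coeff-++ (δ (init a)) (δ (mid a)) (init b)) ⟩
    coeff (δ (init a)) (init b) + coeff (δ (mid a)) (init b) + coeff (δ (fin a)) (init b) ∎
    where
    open ≡-Reasoning
    a≢[] : a ≢ []
    a≢[] refl = contradiction (subst (0 <_) wb≡wa 0<wb) λ ()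
    fibre : ∀ a′ → coeff (δ a) a′ ≢ 0ℤ → init a′ ≡ init b → a′ ≡ b
    fibre a′ ≢0 = init-injective a′ b (subst (0 <_) (sym wa′≡wb) 0<wb) wa′≡wb
      where
      wa′≡wb : weight a′ ≡ weight b
      wa′≡wb = trans (proj₂ (δ-support a adm a′ ≢0)) (sym wb≡wa)

  lhs-odd : ∀ k c → evenᵇ k ≡ false → lhs k c ≡ 0ℤ
  lhs-odd k c e = self-negating (lhs k c) (begin
    lhs k c
      ≡⟨ signedSum-cong k (λ a∈ → δ-dual _ (proj₁ (𝒜-sound k a∈)) c) ⟨
    signedSum k ((λ a → coeff (δ a) c) ∘ dual)
      ≡⟨ signedSum-dual k (λ a → coeff (δ a) c) ⟩
    σ k * lhs k c
      ≡⟨ cong (_* lhs k c) (σ-odd k e) ⟩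
    -1ℤ * lhs k c
      ≡⟨ ℤP.-1*i≡-i (lhs k c) ⟩
    - lhs k c ∎)
    where open ≡-Reasoning

  lhs-off-weight : ∀ k c → weight c ≢ k → lhs k c ≡ 0ℤ
  lhs-off-weight k c wc≢k = ∑-zero (𝒜 k) λ {a} a∈ → trans (cong (sign a *_) (coeff≡0 a∈)) (ℤP.*-zeroʳ (sign a))
    where
    coeff≡0 : ∀ {a} → a ∈ 𝒜 k → coeff (δ a) c ≡ 0ℤ
    coeff≡0 {a} a∈ with coeff (δ a) c ℤ.≟ 0ℤ | 𝒜-sound k a∈
    ... | yes ≡0 | _        = ≡0
    ... | no  ≢0 | adm , wa = contradiction (trans (proj₂ (δ-support a adm c ≢0)) wa) wc≢k

  lhs-step : ∀ k c → evenᵇ k ≡ true → weight c ≡ suc (suc k) →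
    lhs (suc (suc k)) c ≡ -[1+ 2 ] * ∑< (suc (suc k)) (λ u → lhs u (init c))
  lhs-step k c e wc = begin
    lhs n c
      ≡⟨ signedSum-cong n (λ a∈ → let adm , wa = 𝒜-sound n a∈ in
           coeff-δ _ adm c (subst (0 <_) (sym wc) (s≤s z≤n)) (trans wc (sym wa))) ⟩
    signedSum n (λ a → D (init a) + D (mid a) + D (fin a))
      ≡⟨ trans (signedSum-+ n _ _) (cong (_+ signedSum n (D ∘ fin)) (signedSum-+ n _ _)) ⟩
    I + signedSum n (D ∘ mid) + signedSum n (D ∘ fin)
      ≡⟨ cong₂ (λ x y → I + x + y) (signedSum-mid n D 2≤n e)
                                   (signedSum-fin n D e λ a adm → δ-dual a adm (init c)) ⟩
    I + - ∑< n R + I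
      ≡⟨ cong₂ (λ x y → y + - x + y) R-telescopes (signedSum-init n 2≤n D) ⟩
    - S + - S + - S
      ≡⟨ solve 1 (λ s → (:- s) :+ (:- s) :+ (:- s) := con -[1+ 2 ] :* s) refl S ⟩
    -[1+ 2 ] * S ∎
    where
    open ≡-Reasoning
    open +-*-Solver
    n = suc (suc k)
    2≤n : 2 ≤ n
    2≤n = s≤s (s≤s z≤n)
    D : Composition → ℤ
    D a = coeff (δ a) (init c)
    S = ∑< n (λ u → lhs u (init c))
    I = signedSum n (D ∘ init)
    R : ℕ → ℤ
    R w = signedSum w (D ∘ init ∘ dual)
    R-telescopes : ∑< n R ≡ S
    R-telescopes = ∑<-alternating (λ u → lhs u (init c)) R (λ u → lhs-odd u (init c)) refl refl
      (λ w 2≤w → trans (signedSum-dual w (D ∘ init)) (cong (σ w *_) (signedSum-init w 2≤w D))) n e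

  lhs-recursion : Recursion lhs
  lhs-recursion = record
    { base       = λ c → trans (ℤP.+-identityʳ _) (trans (ℤP.*-identityˡ _) (δ-empty c))
    ; odd        = lhs-odd
    ; off-weight = lhs-off-weight
    ; step       = lhs-step
    }

allEvenᵇ-∷ʳ : ∀ a j → allEvenᵇ (a ∷ʳ j) ≡ allEvenᵇ a ∧ evenᵇ j
allEvenᵇ-∷ʳ []      j = BoolP.∧-identityʳ (evenᵇ j)
allEvenᵇ-∷ʳ (x ∷ a) j = trans (cong (evenᵇ x ∧_) (allEvenᵇ-∷ʳ a j)) (sym (BoolP.∧-assoc (evenᵇ x) _ _))

allEvenᵇ⇒evenᵇ-weight : ∀ a → allEvenᵇ a ≡ true → evenᵇ (weight a) ≡ true
allEvenᵇ⇒evenᵇ-weight []      _ = refl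
allEvenᵇ⇒evenᵇ-weight (x ∷ a) e with evenᵇ x in ex
... | true = trans (evenᵇ-+ x (weight a) ex) (allEvenᵇ⇒evenᵇ-weight a e)

coeff-singleton-∷ʳ : ∀ x b j c → 0 < weight c → weight (b ∷ʳ j) ≡ weight c →
  coeff ((x , b ∷ʳ j) ∷ []) c ≡ coeff ((x , b) ∷ []) (init c)
coeff-singleton-∷ʳ x b j c 0<wc w≡wc with ≡-dec ℕ._≟_ b (init c)
... | yes refl = begin
  coeff ((x , init c ∷ʳ j) ∷ []) c ≡⟨ cong (λ d → coeff ((x , d) ∷ []) c) c∷ʳj≡c ⟩
  coeff ((x , c) ∷ []) c           ≡⟨ coeff-singleton-≡ x c ⟩
  x                                ≡⟨ ℤP.+-identityʳ x ⟨
  x + 0ℤ                           ∎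
  where
  open ≡-Reasoning
  c∷ʳj≡c : init c ∷ʳ j ≡ c
  c∷ʳj≡c = init-injective _ c (subst (0 <_) (sym w≡wc) 0<wc) w≡wc (init-∷ʳ (init c) j)
... | no b≢ic = coeff-singleton-≢ x (b ∷ʳ j) λ b∷ʳj≡c → b≢ic (trans (sym (init-∷ʳ b j)) (cong init b∷ʳj≡c))

allEvenᵇ-∷ʳ-even : ∀ b j → evenᵇ (weight b ℕ.+ j) ≡ true → allEvenᵇ (b ∷ʳ j) ≡ allEvenᵇ b
allEvenᵇ-∷ʳ-even b j e with allEvenᵇ b in ae
... | false = trans (allEvenᵇ-∷ʳ b j) (cong (_∧ evenᵇ j) ae)
... | true  = trans (allEvenᵇ-∷ʳ b j) (cong₂ _∧_ ae
                (trans (sym (evenᵇ-+ (weight b) j (allEvenᵇ⇒evenᵇ-weight b ae))) e))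

rhsTerm : Composition → Composition → ℤ
rhsTerm c a = if allEvenᵇ a then coeff ((-[1+ 2 ] ^ depth a , a) ∷ []) c else 0ℤ

rhs : ℕ → Composition → ℤ
rhs k c = ∑[ a ∈ 𝒜 k ] rhsTerm c a

coeff-rhs : ∀ k c → coeff (map (λ a → (-[1+ 2 ] ^ depth a , a)) (𝒜even k)) c ≡ rhs k c
coeff-rhs k c = trans (coeff-map _ (𝒜even k) c) (∑-filterᵇ allEvenᵇ (𝒜 k) _)

rhsTerm-∷ʳ : ∀ c b j → 0 < weight c → weight b ℕ.+ j ≡ weight c → evenᵇ (weight c) ≡ true →
  rhsTerm c (b ∷ʳ j) ≡ -[1+ 2 ] * rhsTerm (init c) b
rhsTerm-∷ʳ c b j 0<wc w≡wc e
  rewrite allEvenᵇ-∷ʳ-even b j (trans (cong evenᵇ w≡wc) e) with allEvenᵇ b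
... | false = refl
... | true  = begin
  coeff ((-[1+ 2 ] ^ depth (b ∷ʳ j) , b ∷ʳ j) ∷ []) c
    ≡⟨ coeff-singleton-∷ʳ _ b j c 0<wc (trans (weight-∷ʳ b j) w≡wc) ⟩
  coeff ((-[1+ 2 ] ^ depth (b ∷ʳ j) , b) ∷ []) (init c)
    ≡⟨ cong (λ d → coeff ((-[1+ 2 ] ^ d , b) ∷ []) (init c)) (depth-∷ʳ b j) ⟩
  coeff (-[1+ 2 ] · ((-[1+ 2 ] ^ depth b , b) ∷ [])) (init c)
    ≡⟨ coeff-· -[1+ 2 ] ((-[1+ 2 ] ^ depth b , b) ∷ []) (init c) ⟩
  -[1+ 2 ] * coeff ((-[1+ 2 ] ^ depth b , b) ∷ []) (init c) ∎
  where open ≡-Reasoning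

rhs-odd : ∀ k c → evenᵇ k ≡ false → rhs k c ≡ 0ℤ
rhs-odd k c e = ∑-zero (𝒜 k) term≡0
  where
  term≡0 : ∀ {a} → a ∈ 𝒜 k → rhsTerm c a ≡ 0ℤ
  term≡0 {a} a∈ with allEvenᵇ a in ae
  ... | false = refl
  ... | true  = contradiction (trans (sym (allEvenᵇ⇒evenᵇ-weight a ae)) (trans (cong evenᵇ (proj₂ (𝒜-sound k a∈))) e)) λ ()

rhs-off-weight : ∀ k c → weight c ≢ k → rhs k c ≡ 0ℤ
rhs-off-weight k c wc≢k = ∑-zero (𝒜 k) term≡0
  where
  term≡0 : ∀ {a} → a ∈ 𝒜 k → rhsTerm c a ≡ 0ℤ
  term≡0 {a} a∈ with allEvenᵇ a
  ... | false = refl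
  ... | true  = coeff-singleton-≢ _ a λ { refl → wc≢k (proj₂ (𝒜-sound k a∈)) }

rhs-step : ∀ k c → evenᵇ k ≡ true → weight c ≡ suc (suc k) →
  rhs (suc (suc k)) c ≡ -[1+ 2 ] * ∑< (suc (suc k)) (λ u → rhs u (init c))
rhs-step k c e wc = begin
  rhs n c
    ≡⟨ ∑-𝒜-∷ʳ n (s≤s (s≤s z≤n)) (rhsTerm c) ⟩
  ∑< n (λ w → ∑[ b ∈ 𝒜 w ] rhsTerm c (b ∷ʳ (n ∸ w)))
    ≡⟨ ∑<-cong n (λ {w} w<n → ∑-cong (𝒜 w) λ b∈ → drop-last w<n b∈) ⟩
  ∑< n (λ w → ∑[ b ∈ 𝒜 w ] (-[1+ 2 ] * rhsTerm (init c) b))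
    ≡⟨ ∑<-cong n (λ {w} _ → ∑-*ˡ (𝒜 w) -[1+ 2 ] (rhsTerm (init c))) ⟩
  ∑< n (λ w → -[1+ 2 ] * rhs w (init c))
    ≡⟨ ∑<-*ˡ n -[1+ 2 ] (λ w → rhs w (init c)) ⟩
  -[1+ 2 ] * ∑< n (λ u → rhs u (init c)) ∎
  where
  open ≡-Reasoning
  n = suc (suc k)
  drop-last : ∀ {w b} → w < n → b ∈ 𝒜 w → rhsTerm c (b ∷ʳ (n ∸ w)) ≡ -[1+ 2 ] * rhsTerm (init c) b
  drop-last {w} {b} w<n b∈ = rhsTerm-∷ʳ c b (n ∸ w) (subst (0 <_) (sym wc) (s≤s z≤n))
    (trans (cong (ℕ._+ (n ∸ w)) (proj₂ (𝒜-sound w b∈))) (trans (ℕP.m+[n∸m]≡n (ℕP.<⇒≤ w<n)) (sym wc)))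
    (trans (cong evenᵇ wc) e)

rhs-recursion : Recursion rhs
rhs-recursion = record
  { base       = λ c → ℤP.+-identityʳ _
  ; odd        = rhs-odd
  ; off-weight = rhs-off-weight
  ; step       = rhs-step
  }

theorem13 :
    -- δ : ℤ^(𝓑) → ℤ^(𝒜), given on basis elements [a] (a admissible) as δ a
    (δ : Composition → FormalSum) →
    -- δ is well defined on classes [a] = [a̅]
    (∀ a → Admissible a → δ (dual a) ≈ δ a) →
    -- δ(ℤ^(𝓑_k)) ⊂ ℤ^(𝒜_k)
    (∀ a → Admissible a → ∀ b → coeff (δ a) b ≢ 0ℤ →
      Admissible b × weight b ≡ weight a) →
    -- δ([∅]) = ∅
    δ [] ≈ basis [] →
    -- δ([a])^init = δ([a^init]) + δ([a^mid]) + δ([a^fin])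
    (∀ a → Admissible a → a ≢ [] →
      initFS (δ a) ≈ δ (init a) ⊕ δ (mid a) ⊕ δ (fin a)) →
    -- for every even k = 2m ≥ 0
    ∀ (m : ℕ) →
      sumFS (map (λ a → (-1ℤ ^ depth a) · δ a) (𝒜 (2 ℕ.* m)))
        ≈ map (λ a → (-[1+ 2 ] ^ depth a , a)) (𝒜even (2 ℕ.* m))
theorem13 δ δ-dual δ-support δ-empty δ-init m b = begin
  coeff (sumFS (map (λ a → (-1ℤ ^ depth a) · δ a) (𝒜 k))) b
    ≡⟨ coeff-sumFS (λ a → (-1ℤ ^ depth a) · δ a) (𝒜 k) b ⟩
  ∑[ a ∈ 𝒜 k ] coeff ((-1ℤ ^ depth a) · δ a) b
    ≡⟨ ∑-cong (𝒜 k) (λ {a} _ → coeff-· (-1ℤ ^ depth a) (δ a) b) ⟩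
  lhs δ δ-dual δ-support δ-empty δ-init k b
    ≡⟨ Recursion-unique (lhs-recursion δ δ-dual δ-support δ-empty δ-init) rhs-recursion k b ⟩
  rhs k b
    ≡⟨ coeff-rhs k b ⟨
  coeff (map (λ a → (-[1+ 2 ] ^ depth a , a)) (𝒜even k)) b ∎
  where
  open ≡-Reasoning
  k = 2 ℕ.* m
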